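{- Let $a,b$ be relatively prime integers with $1<a<b$, let $S=\langle a,b\rangle$, let $(u,v)$ be the definitely least solution of $ax+by=1$, and let $h=\min I(S)$. Then there are exactly $|v|$ minimal isolated gaps modulo $a$ of $I(S)$, namely $h,\ h+b,\ \dots,\ h+(|v|-1)b$.
   Context: $\langle a,b\rangle=\{\lambda_1a+\lambda_2b:\lambda_1,\lambda_2\in\mathbb{N}\}$. $I(S)$ is the set of isolated gaps of $S$ (elements $x\in\mathbb{N}\setminus S$ with $x-1,x+1\in S$). For $i\in\{1,\dots,a-1\}$, $I_{i,a}(S)=\{s\in I(S): s\equiv i\pmod a\}$; when $I_{i,a}(S)\neq\varnothing$, its smallest element $h_i$ is called a minimal isolated gap modulo $a$ of $I(S)$. The definitely least solution $(u,v)$ of $ax+by=1$ is the integer solution for which both $|u|$ and $|v|$ are least possible; it is unique, and is the unique solution with $|u|\le b/2$, $|v|\le a/2$. -}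

module Defs where

open import Data.Nat using (ℕ; zero; suc; _+_; _*_; _∸_; _≤_; _<_)
open import Data.Integer as ℤ using (ℤ; +_; _-_)
open import Data.Integer.Divisibility as ℤD using ()
open import Data.Product using (Σ; ∃; _×_)
open import Relation.Nullary using (¬_)
open import Relation.Binary.PropositionalEquality using (_≡_; _≢_)

InS : ℕ → ℕ → ℕ → Set
InS a b x = Σ ℕ λ l₁ → Σ ℕ λ l₂ → x ≡ l₁ * a + l₂ * b

-- x ∈ I(S): x ∈ ℕ \ S with x-1 ∈ S and x+1 ∈ S (x-1 must be a natural number, so x ≠ 0).
IsoGap : ℕ → ℕ → ℕ → Set
IsoGap a b x = (x ≢ 0) × (¬ InS a b x) × InS a b (x ∸ 1) × InS a b (suc x)

CongMod : ℕ → ℕ → ℕ → Set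
CongMod a x y = (+ a) ℤD.∣ ((+ x) - (+ y))

-- x is a minimal isolated gap modulo a of I(S): x = min I_{i,a}(S) for some
-- i ∈ {1,…,a-1}, i.e. x ∈ I(S), x ≢ 0 (mod a), and x ≤ every y ∈ I(S) with y ≡ x (mod a).
MinIsoGapMod : ℕ → ℕ → ℕ → Set
MinIsoGapMod a b x =
  IsoGap a b x × (¬ CongMod a x 0) × (∀ y → IsoGap a b y → CongMod a y x → x ≤ y)

DefLeastSol : ℕ → ℕ → ℤ → ℤ → Set
DefLeastSol a b u v =
  ((+ a) ℤ.* u ℤ.+ (+ b) ℤ.* v ≡ + 1) × (2 * ℤ.∣ u ∣ ≤ b) × (2 * ℤ.∣ v ∣ ≤ a)

-- Write U = |u| and V = |v|; then U a and V b differ by one, 2U ≤ b and 2V ≤ a.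
-- Every gap n of S can be written y b − x a with 0 < x and y < a, and y is unique
-- because a and b are coprime.  Since {n − 1, n + 1} = {n + U a − V b, n + V b − U a},
-- an isolated gap has n + U a ∈ S and n + V b ∈ S, which forces x ≤ U and y ≥ a − V;
-- conversely these bounds put both n ± 1 in S.  Hence
-- I(S) = {y b − x a : 0 < x ≤ U, a − V ≤ y < a}.  Isolated gaps are congruent modulo a
-- iff they have the same y, and the least one with a given y has x = U.  So
-- h = min I(S) = a b − U a − V b, and the minimal ones are h + k b for k < V.
module Submission where

open import Defs
open import Data.Integer as ℤ using (ℤ; -[1+_]; ∣_∣; _⊖_)
import Data.Integer.Properties as ℤP
open import Data.List using (_∷_; [])
open import Data.Nat using (ℕ; zero; suc; _+_; _*_; _∸_; _≤_; _<_; z≤n; s≤s; z<s; >-nonZero)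
open import Data.Nat.Coprimality using (Coprime; coprime-divisor)
open import Data.Nat.Divisibility using (_∣_; divides; ∣⇒≤; >⇒∤; ∣m+n∣m⇒∣n)
open import Data.Nat.Properties
open import Data.Nat.Tactic.RingSolver using (solve)
open import Data.Product using (Σ; ∃; _×_; _,_; proj₁; proj₂; swap)
open import Data.Sum using (_⊎_; inj₁; inj₂)
open import Function using (_∘_)
open import Function.Bundles using (_⇔_; mk⇔)
open import Relation.Nullary using (¬_; contradiction)
open import Relation.Binary.PropositionalEquality

private variable a b h m n s t P Q U V : ℕ

Adjacent : ℕ → ℕ → Set
Adjacent P Q = P ≡ suc Q ⊎ Q ≡ suc P

InS-+ : InS a b m → InS a b n → InS a b (m + n)
InS-+ {a} {b} (l₁ , l₂ , refl) (l₁′ , l₂′ , refl) =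
  l₁ + l₁′ , l₂ + l₂′ , solve (l₁ ∷ l₂ ∷ l₁′ ∷ l₂′ ∷ a ∷ b ∷ [])

InS-*a : ∀ k → InS a b (k * a)
InS-*a {a} k = k , 0 , sym (+-identityʳ (k * a))

InS-*b : ∀ k → InS a b (k * b)
InS-*b k = 0 , k , refl

InS-swap : InS a b n → InS b a n
InS-swap {a} {b} (l₁ , l₂ , n≡) = l₂ , l₁ , trans n≡ (+-comm (l₁ * a) (l₂ * b))

gap-as-difference : ∀ {a b n} U → ¬ InS a b n → InS a b (n + U * a) →
                    ∃ λ x → ∃ λ y → 0 < x × x ≤ U × n + x * a ≡ y * b
gap-as-difference {a} {b} {n} U n∉S (r , y , n+Ua≡ra+yb) with <-≤-connex r U
... | inj₂ U≤r with m≤n⇒∃[o]m+o≡n U≤r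
...   | e , refl = contradiction (e , y , n≡ea+yb) n∉S
  where
  n≡ea+yb : n ≡ e * a + y * b
  n≡ea+yb = +-cancelʳ-≡ (U * a) n (e * a + y * b)
    (trans n+Ua≡ra+yb (solve (U ∷ e ∷ a ∷ y ∷ b ∷ [])))
gap-as-difference {a} {b} {n} U n∉S (r , y , n+Ua≡ra+yb) | inj₁ r<U with m≤n⇒∃[o]m+o≡n r<U
...   | o , refl = suc o , y , z<s , s≤s (m≤n+m o r) ,
  +-cancelˡ-≡ (r * a) (n + suc o * a) (y * b) (begin
    r * a + (n + suc o * a) ≡⟨ solve (r ∷ a ∷ n ∷ o ∷ []) ⟩
    n + (suc r + o) * a     ≡⟨ n+Ua≡ra+yb ⟩
    r * a + y * b           ∎)
  where open ≡-Reasoning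

InS-difference : ∀ {n x a y b} → n + x * a ≡ y * b → x ≤ b → a ≤ y → InS a b n
InS-difference {n} {x} {a} n+xa≡yb x≤b a≤y with m≤n⇒∃[o]m+o≡n x≤b | m≤n⇒∃[o]m+o≡n a≤y
... | f , refl | e , refl = f , e ,
  +-cancelʳ-≡ (x * a) n (f * a + e * (x + f)) (trans n+xa≡yb (solve (a ∷ e ∷ x ∷ f ∷ [])))

+U*a∸V*b-InS : ∀ {n x a y b U V} → n + x * a ≡ y * b → x ≤ U → V ≤ y →
               ∃ λ s → InS a b s × n + U * a ≡ s + V * b
+U*a∸V*b-InS {n} {x} {a} {y} {b} {U} {V} n+xa≡yb x≤U V≤y
  with m≤n⇒∃[o]m+o≡n x≤U | m≤n⇒∃[o]m+o≡n V≤y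
... | e , refl | f , refl = e * a + f * b , (e , f , refl) , (begin
  n + (x + e) * a       ≡⟨ solve (n ∷ x ∷ e ∷ a ∷ []) ⟩
  n + x * a + e * a     ≡⟨ cong (_+ e * a) n+xa≡yb ⟩
  (V + f) * b + e * a   ≡⟨ solve (V ∷ f ∷ b ∷ e ∷ a ∷ []) ⟩
  e * a + f * b + V * b ∎)
  where open ≡-Reasoning

+V*b∸U*a-InS : ∀ {n x a V b k U} → n + x * a + V * b ≡ (a + k) * b → x + U ≤ b →
               ∃ λ t → InS a b t × n + V * b ≡ t + U * a
+V*b∸U*a-InS {n} {x} {a} {V} {b} {k} {U} n+xa+Vb≡[a+k]b x+U≤b with m≤n⇒∃[o]m+o≡n x+U≤b
... | g , refl = g * a + k * (x + U + g) , (g , k , refl) ,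
  +-cancelʳ-≡ (x * a) (n + V * (x + U + g)) (g * a + k * (x + U + g) + U * a) (begin
    n + V * (x + U + g) + x * a          ≡⟨ solve (n ∷ V ∷ x ∷ U ∷ g ∷ a ∷ []) ⟩
    n + x * a + V * (x + U + g)          ≡⟨ n+xa+Vb≡[a+k]b ⟩
    (a + k) * (x + U + g)                ≡⟨ solve (a ∷ k ∷ x ∷ U ∷ g ∷ []) ⟩
    g * a + k * (x + U + g) + U * a + x * a ∎)
  where open ≡-Reasoning

∣+m-+n∣≡n∸m : m ≤ n → ∣ ℤ.+ m ℤ.- ℤ.+ n ∣ ≡ n ∸ m
∣+m-+n∣≡n∸m {m} {n} m≤n = trans (cong ∣_∣ (ℤP.m-n≡m⊖n m n)) (ℤP.∣⊖∣-≤ m≤n)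

CongMod-sym : ∀ m n → CongMod a m n → CongMod a n m
CongMod-sym {a} m n = subst (a ∣_) (ℤP.∣i-j∣≡∣j-i∣ (ℤ.+ m) (ℤ.+ n))

CongMod⇒offset : m ≤ n → CongMod a m n → ∃ λ q → n ≡ m + q * a
CongMod⇒offset {m} m≤n a∣n-m with subst (_ ∣_) (∣+m-+n∣≡n∸m m≤n) a∣n-m
... | divides q n∸m≡qa = q , trans (sym (m+[n∸m]≡n m≤n)) (cong (m +_) n∸m≡qa)

offset⇒CongMod : ∀ {a} m q → CongMod a m (m + q * a)
offset⇒CongMod {a} m q =
  subst (a ∣_) (sym (trans (∣+m-+n∣≡n∸m (m≤m+n m (q * a))) (m+n∸m≡n m (q * a)))) (divides q refl)

CongMod-0⇒InS : CongMod a n 0 → InS a b n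
CongMod-0⇒InS {a} {n} a∣n with CongMod⇒offset z≤n (CongMod-sym n 0 a∣n)
... | q , n≡qa = q , 0 , trans n≡qa (sym (+-identityʳ _))

module _ {a b : ℕ} (coprime : Coprime a b) where

  ∣*-<⇒≡0 : ∀ {d} → a ∣ d * b → d < a → d ≡ 0
  ∣*-<⇒≡0 {zero}  _    _   = refl
  ∣*-<⇒≡0 {suc d} a∣db d<a =
    contradiction (coprime-divisor coprime (subst (a ∣_) (*-comm (suc d) b) a∣db)) (>⇒∤ d<a)

  private
    excess-vanishes : ∀ p x q d → p * a + x * b ≡ q * a + (x + d) * b → x + d < a → x + d ≡ x
    excess-vanishes p x q d eq x+d<a =
      trans (cong (x +_) (∣*-<⇒≡0 a∣db (≤-<-trans (m≤n+m d x) x+d<a))) (+-identityʳ x)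
      where
      pa≡qa+db : p * a ≡ q * a + d * b
      pa≡qa+db = +-cancelʳ-≡ (x * b) (p * a) (q * a + d * b)
        (trans eq (solve (q ∷ a ∷ x ∷ d ∷ b ∷ [])))
      a∣db : a ∣ d * b
      a∣db = ∣m+n∣m⇒∣n (divides p (sym pa≡qa+db)) (divides q refl)

  *b-coefficient-unique : ∀ p x q y → p * a + x * b ≡ q * a + y * b → x < a → y < a → x ≡ y
  *b-coefficient-unique p x q y eq x<a y<a with ≤-total x y
  ... | inj₁ x≤y with m≤n⇒∃[o]m+o≡n x≤y
  ...   | d , refl = sym (excess-vanishes p x q d eq y<a)
  *b-coefficient-unique p x q y eq x<a y<a | inj₂ y≤x with m≤n⇒∃[o]m+o≡n y≤x
  ...   | d , refl = excess-vanishes q y p d (sym eq) x<a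

  difference-∉S : ∀ {n x y} → n + x * a ≡ y * b → 0 < x → y < a → ¬ InS a b n
  difference-∉S {x = x} {y} n+xa≡yb 0<x y<a (l₁ , l₂ , refl) = <-irrefl l₂≡y l₂<y
    where
    eq : (l₁ + x) * a + l₂ * b ≡ 0 * a + y * b
    eq = begin
      (l₁ + x) * a + l₂ * b     ≡⟨ solve (l₁ ∷ x ∷ a ∷ l₂ ∷ b ∷ []) ⟩
      l₁ * a + l₂ * b + x * a   ≡⟨ n+xa≡yb ⟩
      y * b                     ∎
      where open ≡-Reasoning
    0<[l₁+x]a : 0 < (l₁ + x) * a
    0<[l₁+x]a = *-monoˡ-< a {{>-nonZero (≤-<-trans z≤n y<a)}} (<-≤-trans 0<x (m≤n+m x l₁))
    l₂<y : l₂ < y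
    l₂<y = *-cancelʳ-< b l₂ y (<-≤-trans (m<n+m (l₂ * b) 0<[l₁+x]a) (≤-reflexive eq))
    l₂≡y : l₂ ≡ y
    l₂≡y = *b-coefficient-unique (l₁ + x) l₂ 0 y eq (<-trans l₂<y y<a) y<a

+-adjacent : P ≡ suc Q → m + P ≡ suc m + Q
+-adjacent {Q = Q} {m} P≡1+Q = trans (cong (m +_) P≡1+Q) (+-suc m Q)

one-apart : P ≡ suc Q → m + P ≡ n + Q → n ≡ suc m
one-apart {Q = Q} {m} {n} P≡1+Q m+P≡n+Q =
  +-cancelʳ-≡ Q n (suc m) (trans (sym m+P≡n+Q) (+-adjacent P≡1+Q))

neighbours⇒InS-shifts : Adjacent P Q → InS a b P → InS a b Q → InS a b m → InS a b (2 + m) →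
                        InS a b (suc m + P) × InS a b (suc m + Q)
neighbours⇒InS-shifts {m = m} (inj₁ P≡1+Q) P∈S Q∈S m∈S 2+m∈S =
  subst (InS _ _) (sym (+-adjacent {m = suc m} P≡1+Q)) (InS-+ 2+m∈S Q∈S) ,
  subst (InS _ _) (+-adjacent {m = m} P≡1+Q) (InS-+ m∈S P∈S)
neighbours⇒InS-shifts (inj₂ Q≡1+P) P∈S Q∈S m∈S 2+m∈S =
  swap (neighbours⇒InS-shifts (inj₁ Q≡1+P) Q∈S P∈S m∈S 2+m∈S)

InS-shifts⇒neighbours : Adjacent P Q → InS a b s → n + P ≡ s + Q → InS a b t → n + Q ≡ t + P →
                        InS a b (n ∸ 1) × InS a b (suc n)
InS-shifts⇒neighbours (inj₁ P≡1+Q) s∈S n+P≡s+Q t∈S n+Q≡t+P =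
  subst (InS _ _) (cong (_∸ 1) (sym (one-apart P≡1+Q (sym n+Q≡t+P)))) t∈S ,
  subst (InS _ _) (one-apart P≡1+Q n+P≡s+Q) s∈S
InS-shifts⇒neighbours (inj₂ Q≡1+P) s∈S n+P≡s+Q t∈S n+Q≡t+P =
  InS-shifts⇒neighbours (inj₁ Q≡1+P) t∈S n+Q≡t+P s∈S n+P≡s+Q

positive-of-≡suc : 1 < a → U * a ≡ suc (V * b) → 0 < U × 0 < V
positive-of-≡suc {U = zero} _ ()
positive-of-≡suc {U = suc U} {V = zero} 1<a Ua≡1 =
  contradiction (m*n≡1⇒n≡1 (suc U) _ Ua≡1) (>⇒≢ 1<a)
positive-of-≡suc {U = suc _} {V = suc _} _ _ = z<s , z<s

Adjacent-positive : 1 < a → 1 < b → Adjacent (U * a) (V * b) → 0 < U × 0 < V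
Adjacent-positive 1<a _ (inj₁ Ua≡1+Vb) = positive-of-≡suc 1<a Ua≡1+Vb
Adjacent-positive _ 1<b (inj₂ Vb≡1+Ua) = swap (positive-of-≡suc 1<b Vb≡1+Ua)

module IsolatedGaps {a b U V : ℕ} (coprime : Coprime a b) (1<a : 1 < a) (1<b : 1 < b)
  (bezout : Adjacent (U * a) (V * b)) (2U≤b : 2 * U ≤ b) (2V≤a : 2 * V ≤ a) where

  0<U : 0 < U
  0<U = proj₁ (Adjacent-positive {U = U} {V = V} 1<a 1<b bezout)

  0<V : 0 < V
  0<V = proj₂ (Adjacent-positive {U = U} {V = V} 1<a 1<b bezout)

  U+U≤b : U + U ≤ b
  U+U≤b = subst (_≤ b) (cong (U +_) (+-identityʳ U)) 2U≤b

  V+V≤a : V + V ≤ a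
  V+V≤a = subst (_≤ a) (cong (V +_) (+-identityʳ V)) 2V≤a

  U≤b : U ≤ b
  U≤b = ≤-trans (m≤m+n U U) U+U≤b

  V≤a : V ≤ a
  V≤a = ≤-trans (m≤m+n V V) V+V≤a

  -- n = y b − x a where y = a − V + k, so that 0 < x ≤ U and a − V ≤ y < a.
  record Coords (n : ℕ) : Set where
    constructor coords
    field
      x k : ℕ
      0<x : 0 < x
      x≤U : x ≤ U
      k<V : k < V
      eq  : n + x * a + V * b ≡ (a + k) * b

  differences⇒coords : ∀ {n x y z p} → ¬ InS a b n →
                       0 < x → x ≤ U → n + x * a ≡ y * b →
                       0 < z → z ≤ V → n + z * b ≡ p * a → Coords n
  differences⇒coords {n} {x} {y} {z} {p} n∉S 0<x x≤U n+xa≡yb 0<z z≤V n+zb≡pa =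
    coords x k 0<x x≤U k<V n+xa+Vb≡[a+k]b
    where
    open ≡-Reasoning
    y<a : y < a
    y<a = ≰⇒> (n∉S ∘ InS-difference n+xa≡yb (≤-trans x≤U U≤b))
    a∣z+y : a ∣ z + y
    a∣z+y = coprime-divisor coprime (divides (p + x) (begin
      b * (z + y)         ≡⟨ solve (b ∷ z ∷ y ∷ []) ⟩
      z * b + y * b       ≡⟨ cong (z * b +_) n+xa≡yb ⟨
      z * b + (n + x * a) ≡⟨ solve (z ∷ b ∷ n ∷ x ∷ a ∷ []) ⟩
      n + z * b + x * a   ≡⟨ cong (_+ x * a) n+zb≡pa ⟩
      p * a + x * a       ≡⟨ solve (p ∷ a ∷ x ∷ []) ⟩
      (p + x) * a         ∎))
    a≤V+y : a ≤ V + y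
    a≤V+y = ≤-trans (∣⇒≤ {{>-nonZero (<-≤-trans 0<z (m≤m+n z y))}} a∣z+y) (+-monoˡ-≤ y z≤V)
    k : ℕ
    k = V + y ∸ a
    a+k≡V+y : a + k ≡ V + y
    a+k≡V+y = m+[n∸m]≡n a≤V+y
    k<V : k < V
    k<V = +-cancelˡ-< a k V (subst₂ _<_ (sym a+k≡V+y) (+-comm V a) (+-monoʳ-< V y<a))
    n+xa+Vb≡[a+k]b : n + x * a + V * b ≡ (a + k) * b
    n+xa+Vb≡[a+k]b = begin
      n + x * a + V * b ≡⟨ cong (_+ V * b) n+xa≡yb ⟩
      y * b + V * b     ≡⟨ solve (y ∷ b ∷ V ∷ []) ⟩
      (V + y) * b       ≡⟨ cong (_* b) a+k≡V+y ⟨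
      (a + k) * b       ∎

  isoGap⇒coords : IsoGap a b n → Coords n
  isoGap⇒coords {zero}  (0≢0 , _) = contradiction refl 0≢0
  isoGap⇒coords {suc m} (_ , n∉S , m∈S , 2+m∈S)
    with neighbours⇒InS-shifts bezout (InS-*a U) (InS-*b V) m∈S 2+m∈S
  ... | n+Ua∈S , n+Vb∈S
    with gap-as-difference U n∉S n+Ua∈S | gap-as-difference V (n∉S ∘ InS-swap) (InS-swap n+Vb∈S)
  ... | x , y , 0<x , x≤U , n+xa≡yb | z , p , 0<z , z≤V , n+zb≡pa =
    differences⇒coords {y = y} {p = p} n∉S 0<x x≤U n+xa≡yb 0<z z≤V n+zb≡pa

  coords⇒isoGap : Coords n → IsoGap a b n
  coords⇒isoGap {n} (coords x k 0<x x≤U k<V n+xa+Vb≡[a+k]b) = n≢0 , n∉S , neighbours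
    where
    open ≡-Reasoning
    y : ℕ
    y = a + k ∸ V
    V+y≡a+k : V + y ≡ a + k
    V+y≡a+k = m+[n∸m]≡n (≤-trans V≤a (m≤m+n a k))
    y<a : y < a
    y<a = +-cancelˡ-< V y a (subst₂ _<_ (sym V+y≡a+k) (+-comm a V) (+-monoʳ-< a k<V))
    V≤y : V ≤ y
    V≤y = +-cancelˡ-≤ V V y (≤-trans V+V≤a (≤-trans (m≤m+n a k) (≤-reflexive (sym V+y≡a+k))))
    n+xa≡yb : n + x * a ≡ y * b
    n+xa≡yb = +-cancelʳ-≡ (V * b) (n + x * a) (y * b) (begin
      n + x * a + V * b ≡⟨ n+xa+Vb≡[a+k]b ⟩
      (a + k) * b       ≡⟨ cong (_* b) V+y≡a+k ⟨
      (V + y) * b       ≡⟨ *-distribʳ-+ b V y ⟩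
      V * b + y * b     ≡⟨ +-comm (V * b) (y * b) ⟩
      y * b + V * b     ∎)
    n∉S : ¬ InS a b n
    n∉S = difference-∉S coprime n+xa≡yb 0<x y<a
    n≢0 : n ≢ 0
    n≢0 n≡0 = n∉S (subst (InS a b) (sym n≡0) (InS-*a 0))
    neighbours : InS a b (n ∸ 1) × InS a b (suc n)
    neighbours
      with +U*a∸V*b-InS {n} {x} {a} {y} {b} n+xa≡yb x≤U V≤y
         | +V*b∸U*a-InS {n} {x} {a} {V} {b} {k} n+xa+Vb≡[a+k]b
             (≤-trans (+-monoˡ-≤ U x≤U) U+U≤b)
    ... | s , s∈S , n+Ua≡s+Vb | t , t∈S , n+Vb≡t+Ua =
      InS-shifts⇒neighbours bezout s∈S n+Ua≡s+Vb t∈S n+Vb≡t+Ua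

  a*b≤+U*a+V*b : Coords n → a * b ≤ n + U * a + V * b
  a*b≤+U*a+V*b {n} (coords x k _ x≤U _ n+xa+Vb≡[a+k]b) = begin
    a * b             ≤⟨ *-monoˡ-≤ b (m≤m+n a k) ⟩
    (a + k) * b       ≡⟨ n+xa+Vb≡[a+k]b ⟨
    n + x * a + V * b ≤⟨ +-monoˡ-≤ (V * b) (+-monoʳ-≤ n (*-monoˡ-≤ a x≤U)) ⟩
    n + U * a + V * b ∎
    where open ≤-Reasoning

  U*a+V*b≤a*b : U * a + V * b ≤ a * b
  U*a+V*b≤a*b = *-cancelˡ-≤ 2 (begin
    2 * (U * a + V * b)     ≡⟨ solve (U ∷ a ∷ V ∷ b ∷ []) ⟩
    2 * U * a + 2 * V * b   ≤⟨ +-mono-≤ (*-monoˡ-≤ a 2U≤b) (*-monoˡ-≤ b 2V≤a) ⟩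
    b * a + a * b           ≡⟨ solve (a ∷ b ∷ []) ⟩
    2 * (a * b)             ∎)
    where open ≤-Reasoning

  least⇒+U*a+V*b≡a*b : IsoGap a b h → (∀ n → IsoGap a b n → h ≤ n) → h + U * a + V * b ≡ a * b
  least⇒+U*a+V*b≡a*b h∈I h-least = ≤-antisym
    (≤-trans (+-monoˡ-≤ (V * b) (+-monoˡ-≤ (U * a) (h-least h₀ (coords⇒isoGap h₀-coords))))
             (≤-reflexive h₀+U*a+V*b≡a*b))
    (a*b≤+U*a+V*b (isoGap⇒coords h∈I))
    where
    h₀ : ℕ
    h₀ = a * b ∸ (U * a + V * b)
    h₀+U*a+V*b≡a*b : h₀ + U * a + V * b ≡ a * b
    h₀+U*a+V*b≡a*b = trans (+-assoc h₀ (U * a) (V * b)) (m∸n+n≡m U*a+V*b≤a*b)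
    h₀-coords : Coords h₀
    h₀-coords = coords U 0 0<U ≤-refl 0<V (trans h₀+U*a+V*b≡a*b (cong (_* b) (sym (+-identityʳ a))))

  private
    offset⇒same-k : ∀ {n q} (c : Coords n) (c′ : Coords (n + q * a)) → Coords.k c ≡ Coords.k c′
    offset⇒same-k {n} {q} (coords x k _ _ k<V eq) (coords x′ k′ _ _ k′<V eq′) =
      *b-coefficient-unique coprime (q + x′) k x k′ (+-cancelˡ-≡ (a * b) _ _ (begin
        a * b + ((q + x′) * a + k * b)     ≡⟨ solve (a ∷ b ∷ q ∷ x′ ∷ k ∷ []) ⟩
        (a + k) * b + (q + x′) * a         ≡⟨ cong (_+ (q + x′) * a) eq ⟨
        n + x * a + V * b + (q + x′) * a   ≡⟨ solve (n ∷ x ∷ a ∷ V ∷ b ∷ q ∷ x′ ∷ []) ⟩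
        n + q * a + x′ * a + V * b + x * a ≡⟨ cong (_+ x * a) eq′ ⟩
        (a + k′) * b + x * a               ≡⟨ solve (a ∷ k′ ∷ b ∷ x ∷ []) ⟩
        a * b + (x * a + k′ * b)           ∎))
        (<-≤-trans k<V V≤a) (<-≤-trans k′<V V≤a)
      where open ≡-Reasoning

  CongMod⇒same-k : (c : Coords n) (c′ : Coords m) → CongMod a n m → Coords.k c ≡ Coords.k c′
  CongMod⇒same-k {n} {m} c c′ n≡m with ≤-total n m
  ... | inj₁ n≤m with CongMod⇒offset n≤m n≡m
  ...   | q , refl = offset⇒same-k {q = q} c c′
  CongMod⇒same-k {n} {m} c c′ n≡m | inj₂ m≤n with CongMod⇒offset m≤n (CongMod-sym n m n≡m)
  ...   | q , refl = sym (offset⇒same-k {q = q} c′ c)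

  module _ (h+U*a+V*b≡a*b : h + U * a + V * b ≡ a * b) where

    h+k*b-coords : ∀ {k} → k < V → Coords (h + k * b)
    h+k*b-coords {k} k<V = coords U k 0<U ≤-refl k<V (begin
      h + k * b + U * a + V * b ≡⟨ solve (h ∷ k ∷ b ∷ U ∷ a ∷ V ∷ []) ⟩
      h + U * a + V * b + k * b ≡⟨ cong (_+ k * b) h+U*a+V*b≡a*b ⟩
      a * b + k * b             ≡⟨ solve (a ∷ b ∷ k ∷ []) ⟩
      (a + k) * b               ∎)
      where open ≡-Reasoning

    coords⇒h+k*b-offset : (c : Coords n) → ∃ λ e → n ≡ h + Coords.k c * b + e * a
    coords⇒h+k*b-offset {n} (coords x k _ x≤U k<V n+xa+Vb≡[a+k]b) with m≤n⇒∃[o]m+o≡n x≤U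
    ... | e , x+e≡U = e , +-cancelʳ-≡ (x * a + V * b) n (h + k * b + e * a) (begin
      n + (x * a + V * b)                 ≡⟨ +-assoc n (x * a) (V * b) ⟨
      n + x * a + V * b                   ≡⟨ n+xa+Vb≡[a+k]b ⟩
      (a + k) * b                         ≡⟨ Coords.eq (h+k*b-coords k<V) ⟨
      h + k * b + U * a + V * b           ≡⟨ cong (λ u → h + k * b + u * a + V * b) x+e≡U ⟨
      h + k * b + (x + e) * a + V * b     ≡⟨ solve (h ∷ k ∷ b ∷ x ∷ e ∷ a ∷ V ∷ []) ⟩
      h + k * b + e * a + (x * a + V * b) ∎)
      where open ≡-Reasoning

    h+k*b≤ : (c : Coords n) → h + Coords.k c * b ≤ n
    h+k*b≤ c with coords⇒h+k*b-offset c
    ... | e , n≡h+kb+ea = ≤-trans (m≤m+n _ (e * a)) (≤-reflexive (sym n≡h+kb+ea))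

    minimal⇒h+k*b : MinIsoGapMod a b n → ∃ λ k → k < V × n ≡ h + k * b
    minimal⇒h+k*b (n∈I , _ , n-least) with isoGap⇒coords n∈I
    ... | c@(coords _ k _ _ k<V _) with coords⇒h+k*b-offset c
    ...   | e , refl = k , k<V , ≤-antisym
      (n-least _ (coords⇒isoGap (h+k*b-coords k<V)) (offset⇒CongMod (h + k * b) e))
      (m≤m+n _ _)

    h+k*b⇒minimal : (∃ λ k → k < V × n ≡ h + k * b) → MinIsoGapMod a b n
    h+k*b⇒minimal (k , k<V , refl) =
      coords⇒isoGap h+kb-coords , h+kb∉S ∘ CongMod-0⇒InS , h+kb-least
      where
      h+kb-coords : Coords (h + k * b)
      h+kb-coords = h+k*b-coords k<V
      h+kb∉S : ¬ InS a b (h + k * b)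
      h+kb∉S = proj₁ (proj₂ (coords⇒isoGap h+kb-coords))
      h+kb-least : ∀ m → IsoGap a b m → CongMod a m (h + k * b) → h + k * b ≤ m
      h+kb-least m m∈I m≡h+kb =
        subst (λ j → h + j * b ≤ m) (CongMod⇒same-k c h+kb-coords m≡h+kb) (h+k*b≤ c)
        where
        c : Coords m
        c = isoGap⇒coords m∈I

    minimal⇔h+k*b : ∀ n → MinIsoGapMod a b n ⇔ (∃ λ k → k < V × n ≡ h + k * b)
    minimal⇔h+k*b n = mk⇔ minimal⇒h+k*b h+k*b⇒minimal

⊖≡1⇒≡suc : ∀ m n → m ⊖ n ≡ ℤ.+ 1 → m ≡ suc n
⊖≡1⇒≡suc zero    zero    ()
⊖≡1⇒≡suc zero    (suc n) ()
⊖≡1⇒≡suc (suc m) zero    eq = ℤP.+-injective eq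
⊖≡1⇒≡suc (suc m) (suc n) eq = cong suc (⊖≡1⇒≡suc m n (trans (sym (ℤP.[1+m]⊖[1+n]≡m⊖n m n)) eq))

*+*≢1 : 1 < a → 1 < b → a * m + b * n ≢ 1
*+*≢1 {a} {b} {zero} {n} _ 1<b eq =
  >⇒≢ 1<b (m*n≡1⇒m≡1 b n (trans (cong (_+ b * n) (sym (*-zeroʳ a))) eq))
*+*≢1 {a} {m = suc m} 1<a _ eq =
  <⇒≱ 1<a (≤-trans (m≤m*n a (suc m)) (≤-trans (m≤m+n _ _) (≤-reflexive eq)))

opposite-signs : ∀ {a b u v} → 1 < a → 1 < b → ℤ.+ a ℤ.* u ℤ.+ ℤ.+ b ℤ.* v ≡ ℤ.+ 1 →
                 Adjacent (∣ u ∣ * a) (∣ v ∣ * b)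
opposite-signs {a} {b} {ℤ.+ m} {ℤ.+ n} 1<a 1<b eq =
  contradiction (ℤP.+-injective (trans (cong₂ ℤ._+_ (ℤP.pos-* a m) (ℤP.pos-* b n)) eq))
                (*+*≢1 1<a 1<b)
-- Matching 1 < b against s≤s makes b a successor, so that ℤ.+ b ℤ.* -[1+ n ] computes
-- to a negative literal and eq is literally an equation (a * m) ⊖ (b * suc n) ≡ ℤ.+ 1.
opposite-signs {a} {b} {ℤ.+ m} { -[1+ n ]} _ (s≤s _) eq = inj₁ (begin
  m * a            ≡⟨ *-comm m a ⟩
  a * m            ≡⟨ ⊖≡1⇒≡suc (a * m) (b * suc n) (trans (cong₂ ℤ._+_ (ℤP.pos-* a m) refl) eq) ⟩
  suc (b * suc n)  ≡⟨ cong suc (*-comm b (suc n)) ⟩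
  suc (suc n * b)  ∎)
  where open ≡-Reasoning
opposite-signs {a} {b} { -[1+ m ]} {ℤ.+ n} (s≤s _) _ eq = inj₂ (begin
  n * b            ≡⟨ *-comm n b ⟩
  b * n            ≡⟨ ⊖≡1⇒≡suc (b * n) (a * suc m)
                        (trans (cong (ℤ._+_ (ℤ.+ a ℤ.* -[1+ m ])) (ℤP.pos-* b n)) eq) ⟩
  suc (a * suc m)  ≡⟨ cong suc (*-comm a (suc m)) ⟩
  suc (suc m * a)  ∎)
  where open ≡-Reasoning
opposite-signs {u = -[1+ _ ]} {v = -[1+ _ ]} (s≤s _) (s≤s _) ()

proposition4p2 : (a b : ℕ) → Coprime a b → 1 < a → a < b →
    (u v : ℤ) → DefLeastSol a b u v →
    (h : ℕ) → IsoGap a b h → (∀ y → IsoGap a b y → h ≤ y) →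
    (∀ x → MinIsoGapMod a b x ⇔ Σ ℕ (λ k → (k < ∣ v ∣) × (x ≡ h + k * b)))
proposition4p2 a b coprime 1<a a<b u v (au+bv≡1 , 2∣u∣≤b , 2∣v∣≤a) h h∈I h-least =
  minimal⇔h+k*b (least⇒+U*a+V*b≡a*b h∈I h-least)
  where
  1<b : 1 < b
  1<b = <-trans 1<a a<b
  open IsolatedGaps {U = ∣ u ∣} {V = ∣ v ∣} coprime 1<a 1<b (opposite-signs 1<a 1<b au+bv≡1)
                    2∣u∣≤b 2∣v∣≤a
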